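{- Let $\Sigma$ be a finite alphabet with $|\Sigma|\ge2$, $k\ge2$, let $M$ be an MDS of $D_k$ and let $f_1,f_2\in\Sigma^{k-1}$ be two distinct F-moves, both valid in $M$. Then $f_1$ is valid in $f_2M$, $f_2$ is valid in $f_1M$, and $f_1f_2M=f_2f_1M$.
   Context: $D_k$ is the de Bruijn graph with vertex set $\Sigma^k$ and edges $u\to v$ whenever the length-$(k-1)$ suffix of $u$ equals the length-$(k-1)$ prefix of $v$. A decycling set is $M\subseteq\Sigma^k$ with $D_k\setminus M$ acyclic; an MDS is a decycling set of minimum size. For $f\in\Sigma^{k-1}$, $\mathrm{lc}(f)=\{af:a\in\Sigma\}$, $\mathrm{rc}(f)=\{fa:a\in\Sigma\}$. The F-move $f$ is valid in $M$ if $\mathrm{lc}(f)\subseteq M$, and then $fM=(M\setminus\mathrm{lc}(f))\cup\mathrm{rc}(f)$. -}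

module Defs where

open import Data.Nat using (ℕ; zero; suc; _+_; _≤_)
open import Data.Fin using (Fin)
import Data.Fin.Properties as FinP
open import Data.Vec using (Vec; []; _∷_; tail; init; _∷ʳ_; map; concat)
open import Data.Vec.Properties using (≡-dec)
open import Data.List using (List; []; _∷_; concatMap; allFin; filter; length)
import Data.List as L
open import Data.Bool using (Bool; true; false; _∧_; _∨_; not; T)
open import Data.Product using (∃; _×_; _,_)
open import Relation.Nullary using (¬_; does)
open import Relation.Binary.PropositionalEquality using (_≡_)

Word : ℕ → ℕ → Set
Word q n = Vec (Fin q) n

WordSet : ℕ → ℕ → Set
WordSet q n = Word q n → Bool

allWords : (q n : ℕ) → List (Word q n)
allWords q zero = [] ∷ []
allWords q (suc n) = concatMap (λ a → L.map (a ∷_) (allWords q n)) (allFin q)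

size : ∀ {q n} → WordSet q n → ℕ
size {q} {n} M = length (filter (λ w → T? (M w)) (allWords q n))
  where
  open import Data.Bool.Properties using () renaming (T? to T?)

-- Edges of the de Bruijn graph D_{m+1}: u → v iff suffix_m(u) = prefix_m(v).
Edge : ∀ {q m} → Word q (suc m) → Word q (suc m) → Set
Edge u v = tail u ≡ init v

-- Non-empty walks in D_{m+1} \ M (all vertices outside M).
data Walk {q m : ℕ} (M : WordSet q (suc m)) : Word q (suc m) → Word q (suc m) → Set where
  edge : ∀ {u v} → M u ≡ false → M v ≡ false → Edge u v → Walk M u v
  snoc : ∀ {u v w} → Walk M u v → Edge v w → M w ≡ false → Walk M u w

Decycling : ∀ {q m} → WordSet q (suc m) → Set
Decycling M = ¬ ∃ λ u → Walk M u u

MDS : ∀ {q m} → WordSet q (suc m) → Set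
MDS {q} {m} M = Decycling M × (∀ (M' : WordSet q (suc m)) → Decycling M' → size M ≤ size M')

inLC : ∀ {q m} → Word q m → WordSet q (suc m)
inLC f w = does (≡-dec FinP._≟_ (tail w) f)

inRC : ∀ {q m} → Word q m → WordSet q (suc m)
inRC f w = does (≡-dec FinP._≟_ (init w) f)

Valid : ∀ {q m} → Word q m → WordSet q (suc m) → Set
Valid {q} f M = ∀ (a : Fin q) → M (a ∷ f) ≡ true

move : ∀ {q m} → Word q m → WordSet q (suc m) → WordSet q (suc m)
move f M w = (M w ∧ not (inLC f w)) ∨ inRC f w

{-# OPTIONS --safe #-}
-- If a word w = a f₁ = f₂ b lay in lc(f₁) ∩ rc(f₂), then w ∈ M, and every
-- predecessor c f₂ of w lies in lc(f₂) ⊆ M and differs from w (as f₁ ≢ f₂);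
-- so no cycle of D_k ∖ (M ∖ {w}) can enter w, and M ∖ {w} would be a smaller
-- decycling set. Hence lc(f₁) ∩ rc(f₂) = lc(f₂) ∩ rc(f₁) = ∅, and on each
-- word both composite moves compute "(M ∖ lc f₁ ∖ lc f₂) ∪ rc f₁ ∪ rc f₂".
module Submission where

open import Defs
open import Data.Nat using (ℕ; zero; suc; _≤_; _<_; s≤s)
open import Data.Nat.Properties using (m<n⇒m<1+n; <⇒≱)
import Data.Fin.Properties as FinP
open import Data.Product using (_×_; _,_; ∃-syntax; proj₂)
open import Data.Vec using ([]; _∷_; tail; init)
open import Data.Vec.Properties using (≡-dec)
open import Data.List using (_∷_; filter; length)
import Data.List as List
open import Data.List.Membership.Propositional using (_∈_)
open import Data.List.Membership.Propositional.Properties using (∈-concatMap⁺; ∈-map⁺; ∈-allFin)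
open import Data.List.Relation.Unary.Any using (Any; here; there)
import Data.List.Relation.Unary.Any as Any
open import Data.List.Relation.Binary.Sublist.Propositional using (⊆-refl)
open import Data.List.Relation.Binary.Sublist.Propositional.Properties using (filter⁺; length-mono-≤)
open import Data.Bool using (true; false; _∧_; _∨_; not; T)
open import Data.Bool.Properties using (T?; T-≡; T-∧; ∧-identityʳ; ∧-distribʳ-∨; ∧-assoc; ∧-comm; ∨-assoc; ∨-comm)
open import Function using (_∘_)
open import Function.Bundles using (Equivalence)
open import Level using (Level)
open import Relation.Nullary using (¬_; does; yes; no; contradiction; _×-dec_)
open import Relation.Nullary.Decidable using (dec-true; dec-false)
open import Relation.Unary using (Pred; Decidable; _⊆_)
open import Relation.Binary.Definitions using (DecidableEquality)
open import Relation.Binary.PropositionalEquality using (_≡_; _≢_; refl; sym; trans; subst; cong; cong₂; module ≡-Reasoning)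

private
  variable
    a ℓ : Level
    A : Set a
    q m n : ℕ

_≟_ : DecidableEquality (Word q n)
_≟_ = ≡-dec FinP._≟_

module _ {P Q : Pred A ℓ} (P? : Decidable P) (Q? : Decidable Q) (P⊆Q : P ⊆ Q) where

  length-filter-mono : ∀ xs → length (filter P? xs) ≤ length (filter Q? xs)
  length-filter-mono xs = length-mono-≤ (filter⁺ P? Q? (λ { refl → P⊆Q }) (⊆-refl {x = xs}))

  length-filter-strict : ∀ {xs} → Any (λ x → Q x × ¬ P x) xs →
                         length (filter P? xs) < length (filter Q? xs)
  length-filter-strict {x ∷ xs} (here (qx , ¬px)) with P? x | Q? x
  ... | yes px | _      = contradiction px ¬px
  ... | no _   | yes _  = s≤s (length-filter-mono xs)
  ... | no _   | no ¬qx = contradiction qx ¬qx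
  length-filter-strict {x ∷ xs} (there any) with ih ← length-filter-strict any | P? x | Q? x
  ... | yes px | yes _  = s≤s ih
  ... | yes px | no ¬qx = contradiction (P⊆Q px) ¬qx
  ... | no _   | yes _  = m<n⇒m<1+n ih
  ... | no _   | no _   = ih

∈-allWords : (w : Word q n) → w ∈ allWords q n
∈-allWords {n = zero} []      = here refl
∈-allWords {q} {suc n} (a ∷ w) =
  ∈-concatMap⁺ (λ b → List.map (b ∷_) (allWords q n))
    (Any.map (λ { refl → ∈-map⁺ (a ∷_) (∈-allWords w) }) (∈-allFin a))

remove : WordSet q n → Word q n → WordSet q n
remove M w x = not (does (x ≟ w)) ∧ M x

remove-self : (M : WordSet q n) (w : Word q n) → remove M w w ≡ false
remove-self M w rewrite dec-true (w ≟ w) refl = refl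

remove-≢ : (M : WordSet q n) {w x : Word q n} → x ≢ w → remove M w x ≡ M x
remove-≢ M {w} {x} x≢w rewrite dec-false (x ≟ w) x≢w = refl

size-remove : (M : WordSet q n) (w : Word q n) → M w ≡ true → size (remove M w) < size M
size-remove M w Mw = length-filter-strict (T? ∘ remove M w) (T? ∘ M) (proj₂ ∘ Equivalence.to T-∧)
  (Any.map (λ { refl → Equivalence.from T-≡ Mw , subst T (remove-self M w) }) (∈-allWords w))

module _ {M : WordSet q (suc m)} where

  walk-end : ∀ {u v} → Walk M u v → M v ≡ false
  walk-end (edge _ Mv _) = Mv
  walk-end (snoc _ _ Mv) = Mv

  walk-last-edge : ∀ {u v} → Walk M u v → ∃[ p ] M p ≡ false × Edge p v
  walk-last-edge (edge Mu _ e)   = _ , Mu , e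
  walk-last-edge (snoc walk e _) = _ , walk-end walk , e

module _ (M : WordSet q (suc m)) (w : Word q (suc m))
         (preds-kept : ∀ {p} → Edge p w → remove M w p ≡ true) where

  private
    M∖w = remove M w

    walk-end-≢ : ∀ {u v} → Walk M∖w u v → v ≢ w
    walk-end-≢ walk refl with walk-last-edge walk
    ... | _ , p∉ , p→w = contradiction (trans (sym p∉) (preds-kept p→w)) λ ()

    avoids : ∀ {x} → x ≢ w → M∖w x ≡ false → M x ≡ false
    avoids x≢w = trans (sym (remove-≢ M x≢w))

    restore : ∀ {u v} → Walk M∖w u v → u ≢ w → Walk M u v
    restore walk@(edge Mu Mv e) u≢w = edge (avoids u≢w Mu) (avoids (walk-end-≢ walk) Mv) e
    restore walk@(snoc rest e Mv) u≢w = snoc (restore rest u≢w) e (avoids (walk-end-≢ walk) Mv)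

  remove-decycling : Decycling M → Decycling M∖w
  remove-decycling acyclic (u , cycle) = acyclic (u , restore cycle (walk-end-≢ cycle))

MDS-irredundant : {M : WordSet q (suc m)} → MDS M → ∀ {w} → M w ≡ true →
                  ¬ (∀ {p} → Edge p w → remove M w p ≡ true)
MDS-irredundant {M = M} (acyclic , minimal) {w} Mw preds-kept =
  <⇒≱ (size-remove M w Mw) (minimal (remove M w) (remove-decycling M w preds-kept acyclic))

valid-lc : (M : WordSet q (suc m)) {f : Word q m} → Valid f M → ∀ w → tail w ≡ f → M w ≡ true
valid-lc M valid (a ∷ _) refl = valid a

MDS-lc∩rc-empty : {M : WordSet q (suc m)} → MDS M → {f₁ f₂ : Word q m} → f₁ ≢ f₂ →
                  Valid f₁ M → Valid f₂ M → ∀ w → ¬ (tail w ≡ f₁ × init w ≡ f₂)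
MDS-lc∩rc-empty {M = M} mds {f₁} {f₂} f₁≢f₂ valid₁ valid₂ w (w∈lc , w∈rc) =
  MDS-irredundant mds (valid-lc M valid₁ w w∈lc) preds-kept
  where
  preds-kept : ∀ {p} → Edge p w → remove M w p ≡ true
  preds-kept {p} p→w = trans (remove-≢ M p≢w) (valid-lc M valid₂ p p∈lc)
    where
    p∈lc : tail p ≡ f₂
    p∈lc = trans p→w w∈rc
    p≢w : p ≢ w
    p≢w refl = f₁≢f₂ (trans (sym w∈lc) p∈lc)

valid-move : (M : WordSet q (suc m)) {f g : Word q m} → Valid f M → f ≢ g → Valid f (move g M)
valid-move M {f} {g} valid f≢g a rewrite valid a | dec-false (f ≟ g) f≢g = refl

∧-not-absorb : ∀ l r → l ∧ r ≡ false → r ∧ not l ≡ r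
∧-not-absorb false r _    = ∧-identityʳ r
∧-not-absorb true  false _ = refl

-- x ↦ (x ∧ not l) ∨ r is the effect of a move on a single word.
update-twice : ∀ x l₁ r₁ l₂ r₂ → l₁ ∧ r₂ ≡ false →
                ((x ∧ not l₂) ∨ r₂) ∧ not l₁ ∨ r₁ ≡ x ∧ (not l₂ ∧ not l₁) ∨ (r₂ ∨ r₁)
update-twice x l₁ r₁ l₂ r₂ disjoint = begin
  ((x ∧ not l₂) ∨ r₂) ∧ not l₁ ∨ r₁                ≡⟨ cong (_∨ r₁) (∧-distribʳ-∨ (not l₁) (x ∧ not l₂) r₂) ⟩
  ((x ∧ not l₂) ∧ not l₁ ∨ r₂ ∧ not l₁) ∨ r₁       ≡⟨ cong (λ y → ((x ∧ not l₂) ∧ not l₁ ∨ y) ∨ r₁) (∧-not-absorb l₁ r₂ disjoint) ⟩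
  ((x ∧ not l₂) ∧ not l₁ ∨ r₂) ∨ r₁                ≡⟨ ∨-assoc _ r₂ r₁ ⟩
  (x ∧ not l₂) ∧ not l₁ ∨ (r₂ ∨ r₁)                ≡⟨ cong (_∨ (r₂ ∨ r₁)) (∧-assoc x (not l₂) (not l₁)) ⟩
  x ∧ (not l₂ ∧ not l₁) ∨ (r₂ ∨ r₁)                ∎
  where open ≡-Reasoning

move-comm : (f g : Word q m) (M : WordSet q (suc m)) (w : Word q (suc m)) →
            ¬ (tail w ≡ f × init w ≡ g) → ¬ (tail w ≡ g × init w ≡ f) →
            move f (move g M) w ≡ move g (move f M) w
move-comm f g M w lcf∩rcg lcg∩rcf = begin
  move f (move g M) w
    ≡⟨ update-twice (M w) lf rf lg rg (dec-false (tail w ≟ f ×-dec init w ≟ g) lcf∩rcg) ⟩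
  M w ∧ (not lg ∧ not lf) ∨ (rg ∨ rf)
    ≡⟨ cong₂ _∨_ (cong (M w ∧_) (∧-comm (not lg) (not lf))) (∨-comm rg rf) ⟩
  M w ∧ (not lf ∧ not lg) ∨ (rf ∨ rg)
    ≡⟨ sym (update-twice (M w) lg rg lf rf (dec-false (tail w ≟ g ×-dec init w ≟ f) lcg∩rcf)) ⟩
  move g (move f M) w
    ∎
  where
  open ≡-Reasoning
  lf = inLC f w
  lg = inLC g w
  rf = inRC f w
  rg = inRC g w

lemma1 : (q m : ℕ) → 2 ≤ q → 1 ≤ m →
    (M : WordSet q (suc m)) → MDS M →
    (f₁ f₂ : Word q m) → f₁ ≢ f₂ → Valid f₁ M → Valid f₂ M →
    Valid f₁ (move f₂ M) × Valid f₂ (move f₁ M) ×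
    (∀ w → move f₁ (move f₂ M) w ≡ move f₂ (move f₁ M) w)
lemma1 _ _ _ _ M mds f₁ f₂ f₁≢f₂ valid₁ valid₂ =
  valid-move M valid₁ f₁≢f₂ ,
  valid-move M valid₂ f₂≢f₁ ,
  λ w → move-comm f₁ f₂ M w (MDS-lc∩rc-empty mds f₁≢f₂ valid₁ valid₂ w)
                            (MDS-lc∩rc-empty mds f₂≢f₁ valid₂ valid₁ w)
  where
  f₂≢f₁ : f₂ ≢ f₁
  f₂≢f₁ = f₁≢f₂ ∘ sym
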